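{- Let $(\alpha,\beta,\gamma)\in\mathbb{Z}[i]^3$ satisfy $\alpha^2+i\beta^2+(1+i)\gamma^2=0$, $\alpha\beta\gamma\neq0$ and $\gcd(\alpha,\beta,\gamma)\in U$. Then $\alpha\beta\gamma\not\equiv0\pmod{1+i}$.
   Context: $\mathbb{Z}[i]$ is the ring of Gaussian integers and $U=\{1,-1,i,-i\}$ its unit group. Congruences modulo $\mu$ mean divisibility by $\mu$ in $\mathbb{Z}[i]$; "$\gcd\in U$" means no common non-unit divisor. -}

module Defs where

open import Data.Integer using (ℤ; +_; -[1+_]) renaming (_+_ to _+ℤ_; _*_ to _*ℤ_; _-_ to _-ℤ_)
open import Data.Product using (∃)
open import Relation.Binary.PropositionalEquality using (_≡_)

record ℤ[i] : Set where
  constructor _+_i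
  field
    re : ℤ
    im : ℤ
open ℤ[i] public

infixl 6 _+G_
infixl 7 _*G_

_+G_ : ℤ[i] → ℤ[i] → ℤ[i]
(a + b i) +G (c + d i) = (a +ℤ c) + (b +ℤ d) i

_*G_ : ℤ[i] → ℤ[i] → ℤ[i]
(a + b i) *G (c + d i) = ((a *ℤ c) -ℤ (b *ℤ d)) + ((a *ℤ d) +ℤ (b *ℤ c)) i

0G 1G iG 1+i : ℤ[i]
0G  = (+ 0) + (+ 0) i
1G  = (+ 1) + (+ 0) i
iG  = (+ 0) + (+ 1) i
1+i = (+ 1) + (+ 1) i

infix 4 _∣G_
_∣G_ : ℤ[i] → ℤ[i] → Set
μ ∣G x = ∃ λ κ → x ≡ κ *G μ

_-G_ : ℤ[i] → ℤ[i] → ℤ[i]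
(a + b i) -G (c + d i) = (a -ℤ c) + (b -ℤ d) i

infix 4 _≡G_[mod_]
_≡G_[mod_] : ℤ[i] → ℤ[i] → ℤ[i] → Set
x ≡G y [mod μ ] = μ ∣G (x -G y)

data IsUnit : ℤ[i] → Set where
  u1  : IsUnit ((+ 1) + (+ 0) i)
  u-1 : IsUnit (-[1+ 0 ] + (+ 0) i)
  ui  : IsUnit ((+ 0) + (+ 1) i)
  u-i : IsUnit ((+ 0) + -[1+ 0 ] i)

GcdInU : ℤ[i] → ℤ[i] → ℤ[i] → Set
GcdInU α β γ = ∀ δ → δ ∣G α → δ ∣G β → δ ∣G γ → IsUnit δ

-- Reduce modulo 4. In ℤ[i]/4 = (ℤ/4)[i] a residue a + b i is divisible by π = 1 + i exactly
-- when a + b is even, and running through all triples of residues shows that a solution of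
-- α² + i β² + π γ² ≡ 0 (mod 4) with π ∣ αβγ has π dividing each of α, β, γ.  Since
-- π ∣ a + b i in ℤ[i] as soon as a + b is even, π would be a common non-unit divisor.
module Submission where

open import Defs
open import Data.Fin using (Fin; toℕ)
open import Data.Fin.Patterns using (0F; 1F)
open import Data.Fin.Properties using (all?; _≟_; toℕ-fromℕ<; fromℕ<-cong)
open import Data.Integer as ℤ using (ℤ; +_; -[1+_]; +[1+_]; _◃_; _⊖_; sign; ∣_∣)
open import Data.Integer.Divisibility.Signed as Signed using (∣ᵤ⇒∣)
open import Data.Integer.Properties using ([1+m]⊖[1+n]≡m⊖n; ◃-inverse; +-identityʳ)
open import Data.Integer.Tactic.RingSolver using (solve-∀)
open import Data.Nat as ℕ using (ℕ; zero; suc; _%_)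
open import Data.Nat.DivMod using (_mod_; %-distribˡ-+; %-distribˡ-*)
open import Data.Nat.Divisibility using (_∣_; _∣?_; divides; ∣n∣m%n⇒∣m)
open import Data.Nat.Properties using (+-suc)
open import Data.Product using (_×_; _,_)
import Data.Product.Properties as Product
open import Data.Sign as Sign using (Sign)
open import Relation.Binary.PropositionalEquality
  using (_≡_; refl; sym; trans; cong; cong₂; subst; module ≡-Reasoning)
open import Relation.Nullary using (¬_)
open import Relation.Nullary.Decidable using (Dec; True; toWitness; map′; _×-dec_; _→-dec_)
open import Relation.Unary using (Pred; Decidable)

open ≡-Reasoning

ℤ₄ : Set
ℤ₄ = Fin 4

infixl 6 _+₄_ _-₄_
infixl 7 _*₄_
infix 8 -₄_

_+₄_ _*₄_ : ℤ₄ → ℤ₄ → ℤ₄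
a +₄ b = (toℕ a ℕ.+ toℕ b) mod 4
a *₄ b = (toℕ a ℕ.* toℕ b) mod 4

-₄_ : ℤ₄ → ℤ₄
-₄ a = (4 ℕ.∸ toℕ a) mod 4

_-₄_ : ℤ₄ → ℤ₄ → ℤ₄
a -₄ b = a +₄ -₄ b

Even₄ : ℤ₄ → Set
Even₄ a = 2 ∣ toℕ a

-- P is read off the expected type, so each law below is stated once, in its signature.
decide : ∀ {n p} {P : Pred (Fin n) p} (P? : Decidable P) → {True (all? P?)} → ∀ i → P i
decide P? {p} = toWitness p

+₄-identityˡ : ∀ a → 0F +₄ a ≡ a
+₄-identityˡ = decide λ a → _ ≟ _

a-₄0≡a : ∀ a → a -₄ 0F ≡ a
a-₄0≡a = decide λ a → _ ≟ _

+₄-comm : ∀ a b → a +₄ b ≡ b +₄ a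
+₄-comm = decide λ a → all? λ b → _ ≟ _

[1+a]-₄[1+b]≡a-₄b : ∀ a b → (1F +₄ a) -₄ (1F +₄ b) ≡ a -₄ b
[1+a]-₄[1+b]≡a-₄b = decide λ a → all? λ b → _ ≟ _

-₄-involutive : ∀ a → -₄ -₄ a ≡ a
-₄-involutive = decide λ a → _ ≟ _

-₄-distrib-+₄ : ∀ a b → -₄ (a +₄ b) ≡ -₄ a +₄ -₄ b
-₄-distrib-+₄ = decide λ a → all? λ b → _ ≟ _

*₄-identityˡ : ∀ a → 1F *₄ a ≡ a
*₄-identityˡ = decide λ a → _ ≟ _

-1*₄a≡-₄a : ∀ a → (-₄ 1F) *₄ a ≡ -₄ a
-1*₄a≡-₄a = decide λ a → _ ≟ _

*₄-interchange : ∀ a b c d → (a *₄ b) *₄ (c *₄ d) ≡ (a *₄ c) *₄ (b *₄ d)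
*₄-interchange = decide λ a → all? λ b → all? λ c → all? λ d → _ ≟ _

even₄-neg : ∀ a → Even₄ (-₄ a) → Even₄ a
even₄-neg = decide λ a → (2 ∣? toℕ (-₄ a)) →-dec (2 ∣? toℕ a)

toℕ-mod : ∀ n → toℕ (n mod 4) ≡ n % 4
toℕ-mod n = toℕ-fromℕ< _

mod-cong : ∀ m n → m % 4 ≡ n % 4 → m mod 4 ≡ n mod 4
mod-cong m n eq = fromℕ<-cong _ _ eq _ _

mod-+ : ∀ m n → (m ℕ.+ n) mod 4 ≡ m mod 4 +₄ n mod 4
mod-+ m n = mod-cong (m ℕ.+ n) (toℕ (m mod 4) ℕ.+ toℕ (n mod 4)) (begin
  (m ℕ.+ n) % 4                         ≡⟨ %-distribˡ-+ m n 4 ⟩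
  (m % 4 ℕ.+ n % 4) % 4                 ≡⟨ cong₂ (λ x y → (x ℕ.+ y) % 4) (toℕ-mod m) (toℕ-mod n) ⟨
  (toℕ (m mod 4) ℕ.+ toℕ (n mod 4)) % 4 ∎)

mod-* : ∀ m n → (m ℕ.* n) mod 4 ≡ (m mod 4) *₄ (n mod 4)
mod-* m n = mod-cong (m ℕ.* n) (toℕ (m mod 4) ℕ.* toℕ (n mod 4)) (begin
  (m ℕ.* n) % 4                         ≡⟨ %-distribˡ-* m n 4 ⟩
  ((m % 4) ℕ.* (n % 4)) % 4             ≡⟨ cong₂ (λ x y → (x ℕ.* y) % 4) (toℕ-mod m) (toℕ-mod n) ⟨
  (toℕ (m mod 4) ℕ.* toℕ (n mod 4)) % 4 ∎)

reduce : ℤ → ℤ₄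
reduce (+ n)    = n mod 4
reduce -[1+ n ] = -₄ (suc n mod 4)

reduce-⊖ : ∀ m n → reduce (m ⊖ n) ≡ m mod 4 -₄ n mod 4
reduce-⊖ m       zero    = sym (a-₄0≡a (m mod 4))
reduce-⊖ zero    (suc n) = sym (+₄-identityˡ (-₄ (suc n mod 4)))
reduce-⊖ (suc m) (suc n) = begin
  reduce (suc m ⊖ suc n)             ≡⟨ cong reduce ([1+m]⊖[1+n]≡m⊖n m n) ⟩
  reduce (m ⊖ n)                     ≡⟨ reduce-⊖ m n ⟩
  m mod 4 -₄ n mod 4                 ≡⟨ [1+a]-₄[1+b]≡a-₄b (m mod 4) (n mod 4) ⟨
  (1F +₄ m mod 4) -₄ (1F +₄ n mod 4) ≡⟨ cong₂ _-₄_ (mod-+ 1 m) (mod-+ 1 n) ⟨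
  suc m mod 4 -₄ suc n mod 4         ∎

reduce-+ : ∀ x y → reduce (x ℤ.+ y) ≡ reduce x +₄ reduce y
reduce-+ (+ m)    (+ n)    = mod-+ m n
reduce-+ (+ m)    -[1+ n ] = reduce-⊖ m (suc n)
reduce-+ -[1+ m ] (+ n)    = trans (reduce-⊖ n (suc m)) (+₄-comm (n mod 4) (-₄ (suc m mod 4)))
reduce-+ -[1+ m ] -[1+ n ] = begin
  -₄ (suc (suc (m ℕ.+ n)) mod 4)       ≡⟨ cong (λ k → -₄ (suc k mod 4)) (+-suc m n) ⟨
  -₄ ((suc m ℕ.+ suc n) mod 4)         ≡⟨ cong -₄_ (mod-+ (suc m) (suc n)) ⟩
  -₄ (suc m mod 4 +₄ suc n mod 4)      ≡⟨ -₄-distrib-+₄ (suc m mod 4) (suc n mod 4) ⟩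
  -₄ (suc m mod 4) +₄ -₄ (suc n mod 4) ∎

reduce-neg : ∀ x → reduce (ℤ.- x) ≡ -₄ reduce x
reduce-neg (+ zero)  = refl
reduce-neg +[1+ n ]  = refl
reduce-neg -[1+ n ]  = sym (-₄-involutive (suc n mod 4))

reduce-- : ∀ x y → reduce (x ℤ.- y) ≡ reduce x -₄ reduce y
reduce-- x y = trans (reduce-+ x (ℤ.- y)) (cong (reduce x +₄_) (reduce-neg y))

reduceSign : Sign → ℤ₄
reduceSign Sign.+ = 1F
reduceSign Sign.- = -₄ 1F

reduceSign-* : ∀ s t → reduceSign (s Sign.* t) ≡ reduceSign s *₄ reduceSign t
reduceSign-* Sign.+ Sign.+ = refl
reduceSign-* Sign.+ Sign.- = refl
reduceSign-* Sign.- Sign.+ = refl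
reduceSign-* Sign.- Sign.- = refl

reduce-◃ : ∀ s n → reduce (s ◃ n) ≡ reduceSign s *₄ (n mod 4)
reduce-◃ Sign.+ zero    = refl
reduce-◃ Sign.- zero    = refl
reduce-◃ Sign.+ (suc n) = sym (*₄-identityˡ (suc n mod 4))
reduce-◃ Sign.- (suc n) = sym (-1*₄a≡-₄a (suc n mod 4))

reduce-signAbs : ∀ x → reduce x ≡ reduceSign (sign x) *₄ (∣ x ∣ mod 4)
reduce-signAbs x = trans (cong reduce (sym (◃-inverse x))) (reduce-◃ (sign x) ∣ x ∣)

reduce-* : ∀ x y → reduce (x ℤ.* y) ≡ reduce x *₄ reduce y
reduce-* x y = begin
  reduce (sign x Sign.* sign y ◃ ∣ x ∣ ℕ.* ∣ y ∣)
    ≡⟨ reduce-◃ (sign x Sign.* sign y) (∣ x ∣ ℕ.* ∣ y ∣) ⟩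
  reduceSign (sign x Sign.* sign y) *₄ ((∣ x ∣ ℕ.* ∣ y ∣) mod 4)
    ≡⟨ cong₂ _*₄_ (reduceSign-* (sign x) (sign y)) (mod-* ∣ x ∣ ∣ y ∣) ⟩
  (reduceSign (sign x) *₄ reduceSign (sign y)) *₄ ((∣ x ∣ mod 4) *₄ (∣ y ∣ mod 4))
    ≡⟨ *₄-interchange (reduceSign (sign x)) (reduceSign (sign y)) (∣ x ∣ mod 4) (∣ y ∣ mod 4) ⟩
  (reduceSign (sign x) *₄ (∣ x ∣ mod 4)) *₄ (reduceSign (sign y) *₄ (∣ y ∣ mod 4))
    ≡⟨ cong₂ _*₄_ (reduce-signAbs x) (reduce-signAbs y) ⟨
  reduce x *₄ reduce y
    ∎

even-reduce⇒even : ∀ z → Even₄ (reduce z) → 2 ∣ ∣ z ∣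
even-reduce⇒even (+ n)    even = ∣n∣m%n⇒∣m (divides 2 refl) (subst (2 ∣_) (toℕ-mod n) even)
even-reduce⇒even -[1+ n ] even = even-reduce⇒even (+ suc n) (even₄-neg (suc n mod 4) even)

1+i∣G-of-even-sum : ∀ a b q → a ℤ.+ b ≡ q ℤ.* + 2 → 1+i ∣G a + b i
1+i∣G-of-even-sum a b q a+b≡2q = q + (b ℤ.- q) i , cong₂ _+_i re≡ (b≡q+[b-q] q b)
  where
  a≡[a+b]-b : ∀ a b → a ≡ (a ℤ.+ b) ℤ.- b
  a≡[a+b]-b = solve-∀
  2q-b≡q-[b-q] : ∀ q b → q ℤ.* + 2 ℤ.- b ≡ q ℤ.* + 1 ℤ.- (b ℤ.- q) ℤ.* + 1
  2q-b≡q-[b-q] = solve-∀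
  b≡q+[b-q] : ∀ q b → b ≡ q ℤ.* + 1 ℤ.+ (b ℤ.- q) ℤ.* + 1
  b≡q+[b-q] = solve-∀
  re≡ : a ≡ q ℤ.* + 1 ℤ.- (b ℤ.- q) ℤ.* + 1
  re≡ = begin
    a                               ≡⟨ a≡[a+b]-b a b ⟩
    (a ℤ.+ b) ℤ.- b                 ≡⟨ cong (ℤ._- b) a+b≡2q ⟩
    q ℤ.* + 2 ℤ.- b                 ≡⟨ 2q-b≡q-[b-q] q b ⟩
    q ℤ.* + 1 ℤ.- (b ℤ.- q) ℤ.* + 1 ∎

ℤ₄[i] : Set
ℤ₄[i] = ℤ₄ × ℤ₄

infixl 6 _+ᵢ_
infixl 7 _*ᵢ_

_+ᵢ_ _*ᵢ_ : ℤ₄[i] → ℤ₄[i] → ℤ₄[i]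
(a , b) +ᵢ (c , d) = a +₄ c , b +₄ d
(a , b) *ᵢ (c , d) = a *₄ c -₄ b *₄ d , a *₄ d +₄ b *₄ c

0ᵢ iᵢ πᵢ : ℤ₄[i]
0ᵢ = 0F , 0F
iᵢ = 0F , 1F
πᵢ = 1F , 1F

infix 4 _≟ᵢ_
_≟ᵢ_ : (x y : ℤ₄[i]) → Dec (x ≡ y)
_≟ᵢ_ = Product.≡-dec _≟_ _≟_

all?ᵢ : {P : ℤ₄[i] → Set} → (∀ x → Dec (P x)) → Dec (∀ x → P x)
all?ᵢ P? = map′ (λ h (a , b) → h a b) (λ h a b → h (a , b)) (all? λ a → all? λ b → P? (a , b))

decideᵢ : {P : ℤ₄[i] → Set} (P? : ∀ x → Dec (P x)) → {True (all?ᵢ P?)} → ∀ x → P x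
decideᵢ P? {p} = toWitness p

π∣ᵢ_ : ℤ₄[i] → Set
π∣ᵢ (a , b) = Even₄ (a +₄ b)

π∣ᵢ? : ∀ x → Dec (π∣ᵢ x)
π∣ᵢ? (a , b) = 2 ∣? toℕ (a +₄ b)

π∣ᵢ-multiple : ∀ κ → π∣ᵢ (κ *ᵢ πᵢ)
π∣ᵢ-multiple = decideᵢ λ κ → π∣ᵢ? (κ *ᵢ πᵢ)

formᵢ : ℤ₄[i] → ℤ₄[i] → ℤ₄[i] → ℤ₄[i]
formᵢ a b c = a *ᵢ a +ᵢ iᵢ *ᵢ (b *ᵢ b) +ᵢ πᵢ *ᵢ (c *ᵢ c)

-- Modulo 2 does not suffice: if π divides γ but neither α nor β, then α² + i β² ≡ ±1 ± i while
-- π γ² ≡ 0 or 2 + 2i (mod 4).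
π∣ᵢ-zero-of-formᵢ : ∀ a b c → formᵢ a b c ≡ 0ᵢ → π∣ᵢ (a *ᵢ b *ᵢ c) → π∣ᵢ a × π∣ᵢ b × π∣ᵢ c
π∣ᵢ-zero-of-formᵢ = decideᵢ λ a → all?ᵢ λ b → all?ᵢ λ c →
  formᵢ a b c ≟ᵢ 0ᵢ →-dec π∣ᵢ? (a *ᵢ b *ᵢ c) →-dec π∣ᵢ? a ×-dec π∣ᵢ? b ×-dec π∣ᵢ? c

reduceᵢ : ℤ[i] → ℤ₄[i]
reduceᵢ (a + b i) = reduce a , reduce b

reduceᵢ-+ : ∀ x y → reduceᵢ (x +G y) ≡ reduceᵢ x +ᵢ reduceᵢ y
reduceᵢ-+ (a + b i) (c + d i) = cong₂ _,_ (reduce-+ a c) (reduce-+ b d)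

reduceᵢ-* : ∀ x y → reduceᵢ (x *G y) ≡ reduceᵢ x *ᵢ reduceᵢ y
reduceᵢ-* (a + b i) (c + d i) = cong₂ _,_
  (trans (reduce-- (a ℤ.* c) (b ℤ.* d)) (cong₂ _-₄_ (reduce-* a c) (reduce-* b d)))
  (trans (reduce-+ (a ℤ.* d) (b ℤ.* c)) (cong₂ _+₄_ (reduce-* a d) (reduce-* b c)))

reduceᵢ-form : ∀ α β γ →
  reduceᵢ (α *G α +G iG *G (β *G β) +G 1+i *G (γ *G γ)) ≡ formᵢ (reduceᵢ α) (reduceᵢ β) (reduceᵢ γ)
reduceᵢ-form α β γ = begin
  reduceᵢ (α *G α +G iG *G (β *G β) +G 1+i *G (γ *G γ))
    ≡⟨ reduceᵢ-+ (α *G α +G iG *G (β *G β)) (1+i *G (γ *G γ)) ⟩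
  reduceᵢ (α *G α +G iG *G (β *G β)) +ᵢ reduceᵢ (1+i *G (γ *G γ))
    ≡⟨ cong₂ _+ᵢ_ (reduceᵢ-+ (α *G α) (iG *G (β *G β))) (reduceᵢ-* 1+i (γ *G γ)) ⟩
  reduceᵢ (α *G α) +ᵢ reduceᵢ (iG *G (β *G β)) +ᵢ πᵢ *ᵢ reduceᵢ (γ *G γ)
    ≡⟨ cong₂ (λ u v → reduceᵢ (α *G α) +ᵢ u +ᵢ πᵢ *ᵢ v) (reduceᵢ-* iG (β *G β)) (reduceᵢ-* γ γ) ⟩
  reduceᵢ (α *G α) +ᵢ iᵢ *ᵢ reduceᵢ (β *G β) +ᵢ πᵢ *ᵢ (reduceᵢ γ *ᵢ reduceᵢ γ)
    ≡⟨ cong₂ (λ u v → u +ᵢ iᵢ *ᵢ v +ᵢ πᵢ *ᵢ (reduceᵢ γ *ᵢ reduceᵢ γ)) (reduceᵢ-* α α) (reduceᵢ-* β β) ⟩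
  formᵢ (reduceᵢ α) (reduceᵢ β) (reduceᵢ γ)
    ∎

π∣ᵢ-reduceᵢ⇒1+i∣G : ∀ x → π∣ᵢ reduceᵢ x → 1+i ∣G x
π∣ᵢ-reduceᵢ⇒1+i∣G (a + b i) π∣x̂
  with Signed.divides q a+b≡q*2 ← ∣ᵤ⇒∣ (even-reduce⇒even (a ℤ.+ b) (subst Even₄ (sym (reduce-+ a b)) π∣x̂))
  = 1+i∣G-of-even-sum a b q a+b≡q*2

-G-identityʳ : ∀ x → x -G 0G ≡ x
-G-identityʳ (a + b i) = cong₂ _+_i (+-identityʳ a) (+-identityʳ b)

lemma4p16 : (α β γ : ℤ[i]) →
    α *G α +G iG *G (β *G β) +G 1+i *G (γ *G γ) ≡ 0G →
    ¬ (α *G β *G γ ≡ 0G) →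
    GcdInU α β γ →
    ¬ (α *G β *G γ ≡G 0G [mod 1+i ])
lemma4p16 α β γ form≡0 _ gcd∈U (κ , αβγ-0≡κπ) =
  let π∣α̂ , π∣β̂ , π∣γ̂ = π∣ᵢ-zero-of-formᵢ α̂ β̂ γ̂ reduced-form≡0 π∣ᵢα̂β̂γ̂ in
  1+i-not-unit (gcd∈U 1+i (π∣ᵢ-reduceᵢ⇒1+i∣G α π∣α̂) (π∣ᵢ-reduceᵢ⇒1+i∣G β π∣β̂) (π∣ᵢ-reduceᵢ⇒1+i∣G γ π∣γ̂))
  where
  α̂ β̂ γ̂ : ℤ₄[i]
  α̂ = reduceᵢ α
  β̂ = reduceᵢ β
  γ̂ = reduceᵢ γ
  reduced-form≡0 : formᵢ α̂ β̂ γ̂ ≡ 0ᵢ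
  reduced-form≡0 = trans (sym (reduceᵢ-form α β γ)) (cong reduceᵢ form≡0)
  π∣ᵢα̂β̂γ̂ : π∣ᵢ (α̂ *ᵢ β̂ *ᵢ γ̂)
  π∣ᵢα̂β̂γ̂ = subst π∣ᵢ_ (begin
    reduceᵢ κ *ᵢ πᵢ            ≡⟨ reduceᵢ-* κ 1+i ⟨
    reduceᵢ (κ *G 1+i)         ≡⟨ cong reduceᵢ (trans (sym αβγ-0≡κπ) (-G-identityʳ (α *G β *G γ))) ⟩
    reduceᵢ (α *G β *G γ)      ≡⟨ reduceᵢ-* (α *G β) γ ⟩
    reduceᵢ (α *G β) *ᵢ γ̂      ≡⟨ cong (_*ᵢ γ̂) (reduceᵢ-* α β) ⟩
    α̂ *ᵢ β̂ *ᵢ γ̂               ∎) (π∣ᵢ-multiple (reduceᵢ κ))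
  1+i-not-unit : ¬ IsUnit 1+i
  1+i-not-unit ()
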